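{- Let $d\in\mathbb{N}$, let $t,u$ be stratified terms and $x$ a variable, and let $r=n_x(t)$, $a=\mathrm{vect}_d(t)$, $b=\mathrm{vect}_d(u)$. Then $\mathrm{vect}_d(t[u/x])\le a+r\cdot b=(a_0+rb_0,\dots,a_{d+1}+rb_{d+1})$ componentwise.
   Context: Terms of $\Lambda_B$: $t,u,v::=x\mid F\mid T\mid \lambda x.t\mid t\,u\mid \mathrm{if}\ t\ \mathrm{then}\ u\ \mathrm{else}\ v$. Stratified terms: terms of $\Lambda_B$ in which every abstraction is annotated by a natural number $k$ (its depth) and possibly also by $!$, written $\lambda^k x.t$ or $\lambda^{k!}x.t$, and every application is possibly annotated by $!$, written $t\,u$ or $t\,!\,u$; substitution $t[u/x]$ is capture-avoiding and keeps annotations. Counts: $n_x(x)=1$, $n_x(y)=0$ ($y\ne x$), $n_x(F)=n_x(T)=0$, $n_x(\lambda y.t)=n_x(t)$, $n_x(t\,u)=n_x(t)+n_x(u)$, $n_x(\mathrm{if}\ t_0\ \mathrm{then}\ t_1\ \mathrm{else}\ t_2)=\max_i n_x(t_i)$. For $k\in\mathbb{N}$: $n_k(x)=n_k(F)=n_k(T)=0$, $n_k(\lambda^k x.t)=n_k(t)+1$ (with or without $!$), $n_k(\lambda^p x.t)=n_k(t)$ for $p\ne k$, $n_k(t\,u)=n_k(t)+n_k(u)$, $n_k(\mathrm{if}\ t_0\ \mathrm{then}\ t_1\ \mathrm{else}\ t_2)=\max_i n_k(t_i)$. The number $n_{if}(t)$ of occurrences of $\mathrm{if}$ is defined similarly: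 $0$ on variables and constants, unchanged through abstraction, additive on application, and $n_{if}(\mathrm{if}\ t_0\ \mathrm{then}\ t_1\ \mathrm{else}\ t_2)=1+\max_i n_{if}(t_i)$. $\mathrm{vect}_d(t)=(n_0(t),\dots,n_d(t),n_{if}(t))\in\mathbb{N}^{d+2}$. For vectors, $a\le b$ means $a_k\le b_k$ for all $k$. -}

module Defs where

open import Data.Nat using (ℕ; zero; suc; _+_; _*_; _⊔_; _≡ᵇ_; _<ᵇ_)
open import Data.Bool using (Bool; true; false; if_then_else_)
open import Data.Fin using (Fin; toℕ)
open import Data.Vec using (Vec; []; _∷_; _++_; tabulate; zipWith; map)
open import Data.Vec.Relation.Binary.Pointwise.Inductive using (Pointwise)
import Data.Nat as ℕ

-- Stratified terms of Λ_B, with variables as de Bruijn indices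
-- (so that substitution is capture-avoiding by construction).
--   lam k b t : λ^k x. t   (b = true means the abstraction is annotated by !)
--   app b t u : t u        (b = true means t ! u)
data STerm : Set where
  var : ℕ → STerm
  F   : STerm
  T   : STerm
  lam : ℕ → Bool → STerm → STerm
  app : Bool → STerm → STerm → STerm
  ite : STerm → STerm → STerm → STerm

shift : ℕ → STerm → STerm
shift c (var y)     = if y <ᵇ c then var y else var (suc y)
shift c F           = F
shift c T           = T
shift c (lam k b t) = lam k b (shift (suc c) t)
shift c (app b t u) = app b (shift c t) (shift c u)
shift c (ite t u v) = ite (shift c t) (shift c u) (shift c v)

subst : STerm → STerm → ℕ → STerm
subst (var y)     u x = if y ≡ᵇ x then u else var y
subst F           u x = F
subst T           u x = T
subst (lam k b t) u x = lam k b (subst t (shift 0 u) (suc x))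
subst (app b t v) u x = app b (subst t u x) (subst v u x)
subst (ite t v w) u x = ite (subst t u x) (subst v u x) (subst w u x)

nvar : ℕ → STerm → ℕ
nvar x (var y)     = if y ≡ᵇ x then 1 else 0
nvar x F           = 0
nvar x T           = 0
nvar x (lam k b t) = nvar (suc x) t
nvar x (app b t u) = nvar x t + nvar x u
nvar x (ite t u v) = nvar x t ⊔ nvar x u ⊔ nvar x v

ndepth : ℕ → STerm → ℕ
ndepth k (var y)     = 0
ndepth k F           = 0
ndepth k T           = 0
ndepth k (lam p b t) = if p ≡ᵇ k then suc (ndepth k t) else ndepth k t
ndepth k (app b t u) = ndepth k t + ndepth k u
ndepth k (ite t u v) = ndepth k t ⊔ ndepth k u ⊔ ndepth k v

nif : STerm → ℕ
nif (var y)     = 0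
nif F           = 0
nif T           = 0
nif (lam p b t) = nif t
nif (app b t u) = nif t + nif u
nif (ite t u v) = suc (nif t ⊔ nif u ⊔ nif v)

vect : (d : ℕ) → STerm → Vec ℕ (suc d + 1)
vect d t = tabulate (λ (i : Fin (suc d)) → ndepth (toℕ i) t) ++ (nif t ∷ [])

_≤ᵛ_ : ∀ {n} → Vec ℕ n → Vec ℕ n → Set
a ≤ᵛ b = Pointwise ℕ._≤_ a b

_+ᵛ_ : ∀ {n} → Vec ℕ n → Vec ℕ n → Vec ℕ n
a +ᵛ b = zipWith _+_ a b

_·ᵛ_ : ∀ {n} → ℕ → Vec ℕ n → Vec ℕ n
r ·ᵛ b = map (r *_) b

module Submission where

-- Every component of vect_d (each n_k and n_if) is an instance of one
-- kind of measure: it takes the same value on all variables, adds a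
-- weight depending only on the depth at an abstraction, is additive on
-- applications, and is a weighted maximum on conditionals.  For any such
-- measure m we prove, by induction on t,
--   (1) m is invariant under shifting de Bruijn indices, and
--   (2) m(t[u/x]) ≤ m(t) + n_x(t) · m(u);
-- for (2) the application and conditional cases need that linear bounds
-- m ≤ a + r·c are stable under + and ⊔.

open import Defs
open import Data.Nat using (ℕ; zero; suc; _+_; _*_; _⊔_; _≤_; _≡ᵇ_; _<ᵇ_)
open import Data.Nat.Properties
  using (≤-trans; ≤-reflexive; +-mono-≤; +-monoʳ-≤; *-monoˡ-≤; +-assoc;
         m≤m+n; m≤n+m; m≤m⊔n; m≤n⊔m; ⊔-lub; module ≤-Reasoning)
open import Data.Bool using (true; false; if_then_else_)
open import Data.Fin using (Fin; toℕ)
import Data.Fin as Fin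
open import Data.Vec using (Vec; []; _∷_; _++_; tabulate)
open import Data.Vec.Properties using (map-++; zipWith-++)
open import Data.Vec.Relation.Binary.Pointwise.Inductive using ([]; _∷_; ++⁺)
open import Relation.Binary.PropositionalEquality
  using (_≡_; refl; sym; cong; module ≡-Reasoning)
open import Data.Nat.Solver using (module +-*-Solver)

+-linear-bound : ∀ {m₁ m₂} a₁ a₂ r₁ r₂ c →
  m₁ ≤ a₁ + r₁ * c → m₂ ≤ a₂ + r₂ * c → m₁ + m₂ ≤ (a₁ + a₂) + (r₁ + r₂) * c
+-linear-bound a₁ a₂ r₁ r₂ c p q =
  ≤-trans (+-mono-≤ p q) (≤-reflexive (regroup a₁ a₂ r₁ r₂ c))
  where
  open +-*-Solver
  regroup : ∀ a₁ a₂ r₁ r₂ c → (a₁ + r₁ * c) + (a₂ + r₂ * c) ≡ (a₁ + a₂) + (r₁ + r₂) * c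
  regroup = solve 5 (λ a₁ a₂ r₁ r₂ c →
    (a₁ :+ r₁ :* c) :+ (a₂ :+ r₂ :* c) := (a₁ :+ a₂) :+ (r₁ :+ r₂) :* c) refl

⊔-linear-bound : ∀ {m₁ m₂} a₁ a₂ r₁ r₂ c →
  m₁ ≤ a₁ + r₁ * c → m₂ ≤ a₂ + r₂ * c → m₁ ⊔ m₂ ≤ (a₁ ⊔ a₂) + (r₁ ⊔ r₂) * c
⊔-linear-bound a₁ a₂ r₁ r₂ c p q = ⊔-lub
  (≤-trans p (+-mono-≤ (m≤m⊔n a₁ a₂) (*-monoˡ-≤ c (m≤m⊔n r₁ r₂))))
  (≤-trans q (+-mono-≤ (m≤n⊔m a₁ a₂) (*-monoˡ-≤ c (m≤n⊔m r₁ r₂))))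

record Measure : Set where
  field
    measure     : STerm → ℕ
    lamWeight   : ℕ → ℕ
    iteWeight   : ℕ
    var-uniform : ∀ y z → measure (var y) ≡ measure (var z)
    measure-lam : ∀ p b t → measure (lam p b t) ≡ lamWeight p + measure t
    measure-app : ∀ b t u → measure (app b t u) ≡ measure t + measure u
    measure-ite : ∀ t u v →
      measure (ite t u v) ≡ iteWeight + (measure t ⊔ measure u ⊔ measure v)

module MeasureProperties (M : Measure) where
  open Measure M

  -- Shifting only renames variables, which the measure cannot see.
  shift-invariant : ∀ c t → measure (shift c t) ≡ measure t
  shift-invariant c (var y) with y <ᵇ c
  ... | true  = refl
  ... | false = var-uniform (suc y) y
  shift-invariant c F = refl
  shift-invariant c T = refl
  shift-invariant c (lam p b t) = begin
    measure (lam p b (shift (suc c) t))     ≡⟨ measure-lam p b _ ⟩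
    lamWeight p + measure (shift (suc c) t) ≡⟨ cong (lamWeight p +_) (shift-invariant (suc c) t) ⟩
    lamWeight p + measure t                 ≡⟨ sym (measure-lam p b t) ⟩
    measure (lam p b t)                     ∎
    where open ≡-Reasoning
  shift-invariant c (app b t u)
    rewrite measure-app b (shift c t) (shift c u) | measure-app b t u
          | shift-invariant c t | shift-invariant c u = refl
  shift-invariant c (ite t u v)
    rewrite measure-ite (shift c t) (shift c u) (shift c v) | measure-ite t u v
          | shift-invariant c t | shift-invariant c u | shift-invariant c v = refl

  -- The scalar substitution bound: each of the n_x(t) copies of u
  -- contributes at most m(u).
  subst-bound : ∀ t u x → measure (subst t u x) ≤ measure t + nvar x t * measure u
  subst-bound (var y) u x with y ≡ᵇ x
  ... | true  = ≤-trans (m≤m+n (measure u) 0) (m≤n+m _ (measure (var y)))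
  ... | false = m≤m+n (measure (var y)) 0
  subst-bound F u x = m≤m+n (measure F) 0
  subst-bound T u x = m≤m+n (measure T) 0
  subst-bound (lam p b t) u x = begin
    measure (lam p b (subst t (shift 0 u) (suc x)))
      ≡⟨ measure-lam p b _ ⟩
    lamWeight p + measure (subst t (shift 0 u) (suc x))
      ≤⟨ +-monoʳ-≤ (lamWeight p) (subst-bound t (shift 0 u) (suc x)) ⟩
    lamWeight p + (measure t + nvar (suc x) t * measure (shift 0 u))
      ≡⟨ cong (λ s → lamWeight p + (measure t + nvar (suc x) t * s)) (shift-invariant 0 u) ⟩
    lamWeight p + (measure t + nvar (suc x) t * measure u)
      ≡⟨ sym (+-assoc (lamWeight p) _ _) ⟩
    (lamWeight p + measure t) + nvar (suc x) t * measure u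
      ≡⟨ cong (_+ nvar (suc x) t * measure u) (sym (measure-lam p b t)) ⟩
    measure (lam p b t) + nvar x (lam p b t) * measure u ∎
    where open ≤-Reasoning
  subst-bound (app b t v) u x
    rewrite measure-app b (subst t u x) (subst v u x) | measure-app b t v =
    +-linear-bound _ _ (nvar x t) (nvar x v) _ (subst-bound t u x) (subst-bound v u x)
  subst-bound (ite t v w) u x = begin
    measure (ite (subst t u x) (subst v u x) (subst w u x))
      ≡⟨ measure-ite _ _ _ ⟩
    iteWeight + (measure (subst t u x) ⊔ measure (subst v u x) ⊔ measure (subst w u x))
      ≤⟨ +-monoʳ-≤ iteWeight branches-bound ⟩
    iteWeight + (measure t ⊔ measure v ⊔ measure w + r * measure u)
      ≡⟨ sym (+-assoc iteWeight _ _) ⟩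
    iteWeight + (measure t ⊔ measure v ⊔ measure w) + r * measure u
      ≡⟨ cong (_+ r * measure u) (sym (measure-ite t v w)) ⟩
    measure (ite t v w) + r * measure u ∎
    where
    open ≤-Reasoning
    r : ℕ
    r = nvar x t ⊔ nvar x v ⊔ nvar x w
    branches-bound : measure (subst t u x) ⊔ measure (subst v u x) ⊔ measure (subst w u x)
                   ≤ measure t ⊔ measure v ⊔ measure w + r * measure u
    branches-bound = ⊔-linear-bound _ _ (nvar x t ⊔ nvar x v) (nvar x w) _
      (⊔-linear-bound _ _ (nvar x t) (nvar x v) _ (subst-bound t u x) (subst-bound v u x))
      (subst-bound w u x)

depthMeasure : ℕ → Measure
depthMeasure k = record
  { measure     = ndepth k
  ; lamWeight   = λ p → if p ≡ᵇ k then 1 else 0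
  ; iteWeight   = 0
  ; var-uniform = λ _ _ → refl
  ; measure-lam = lam-weight
  ; measure-app = λ _ _ _ → refl
  ; measure-ite = λ _ _ _ → refl
  }
  where
  lam-weight : ∀ p b t → ndepth k (lam p b t) ≡ (if p ≡ᵇ k then 1 else 0) + ndepth k t
  lam-weight p b t with p ≡ᵇ k
  ... | true  = refl
  ... | false = refl

ifMeasure : Measure
ifMeasure = record
  { measure     = nif
  ; lamWeight   = λ _ → 0
  ; iteWeight   = 1
  ; var-uniform = λ _ _ → refl
  ; measure-lam = λ _ _ _ → refl
  ; measure-app = λ _ _ _ → refl
  ; measure-ite = λ _ _ _ → refl
  }

tabulate-bound : ∀ {n} (f g h : Fin n → ℕ) (r : ℕ) → (∀ i → f i ≤ g i + r * h i) →
  tabulate f ≤ᵛ (tabulate g +ᵛ (r ·ᵛ tabulate h))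
tabulate-bound {zero} f g h r bound = []
tabulate-bound {suc n} f g h r bound =
  bound Fin.zero ∷ tabulate-bound (f ∘suc) (g ∘suc) (h ∘suc) r (λ i → bound (Fin.suc i))
  where
  _∘suc : (Fin (suc n) → ℕ) → Fin n → ℕ
  (φ ∘suc) i = φ (Fin.suc i)

++-bound : ∀ {m n} {a b c : Vec ℕ m} {a′ b′ c′ : Vec ℕ n} {r : ℕ} →
  a ≤ᵛ (b +ᵛ (r ·ᵛ c)) → a′ ≤ᵛ (b′ +ᵛ (r ·ᵛ c′)) →
  (a ++ a′) ≤ᵛ ((b ++ b′) +ᵛ (r ·ᵛ (c ++ c′)))
++-bound {b = b} {c} {b′ = b′} {c′} {r} p q
  rewrite map-++ (r *_) c c′ | zipWith-++ _+_ b b′ (r ·ᵛ c) (r ·ᵛ c′) = ++⁺ p q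

lemma7 : (d : ℕ) (t u : STerm) (x : ℕ) →
    vect d (subst t u x) ≤ᵛ (vect d t +ᵛ (nvar x t ·ᵛ vect d u))
lemma7 d t u x =
  ++-bound {m = suc d} {r = nvar x t}
    (tabulate-bound _ _ _ (nvar x t) (λ i → depth-bound (toℕ i)))
    (if-bound ∷ [])
  where
  depth-bound : ∀ k → ndepth k (subst t u x) ≤ ndepth k t + nvar x t * ndepth k u
  depth-bound k = MeasureProperties.subst-bound (depthMeasure k) t u x

  if-bound : nif (subst t u x) ≤ nif t + nvar x t * nif u
  if-bound = MeasureProperties.subst-bound ifMeasure t u x
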